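{- For any classical formula $\phi$ of $\mathsf{PT}$, reading tensor disjunction $\otimes$ as classical disjunction (and the remaining connectives classically), $\phi$ is a tautology of classical propositional logic if and only if $\phi$ is valid in team semantics (satisfied by every team).
   Context: A valuation is a function $v:\mathrm{Prop}\to\{0,1\}$; a team is a set of valuations. Formulas of $\mathsf{PT}$: $\phi::=p\mid\neg p\mid\bot\mid\top\mid{=}(p_1,\dots,p_k,q)\mid\phi\wedge\phi\mid\phi\otimes\phi\mid\phi\vee\phi\mid\phi\to\phi$. A formula of $\mathsf{PT}$ is classical if it contains no dependence atoms ${=}(\vec p,q)$ and no $\vee$. Team semantics: $X\models p$ iff $v(p)=1$ for all $v\in X$; $X\models\neg p$ iff $v(p)=0$ for all $v\in X$; $X\models\bot$ iff $X=\emptyset$; $X\models\top$ always; $X\models\phi\wedge\psi$ iff both; $X\models\phi\otimes\psi$ iff $X=Y\cup Z$ with $Y\models\phi$, $Z\models\psi$; $X\models\phi\to\psi$ iff every $Y\subseteq X$ with $Y\models\phi$ satisfies $Y\models\psi$ (and $X\models\phi\vee\psi$ iff $X\models\phi$ or $X\models\psi$; $X\models{=}(\vec p,q)$ iff any $v,v'\in X$ agreeing on $\vec p$ agree on $q$). -}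

module Defs where

open import Data.Nat using (ℕ)
open import Data.Bool using (Bool; true; false; _∧_; _∨_; not)
open import Data.List using (List)
open import Data.List.Relation.Unary.All using (All)
open import Data.Product using (Σ; _×_; ∃)
open import Data.Sum using (_⊎_)
open import Data.Empty using (⊥)
open import Data.Unit using (⊤)
open import Level using (Lift; suc; zero)
open import Relation.Nullary using (¬_)
open import Relation.Binary.PropositionalEquality using (_≡_)

Prop : Set
Prop = ℕ

Valuation : Set
Valuation = Prop → Bool

Team : Set₁
Team = Valuation → Set

_⊆_ : Team → Team → Set
Y ⊆ Z = ∀ v → Y v → Z v

data Form : Set where
  var  : Prop → Form
  neg  : Prop → Form
  bot  : Form
  top  : Form
  dep  : List Prop → Prop → Form
  _∧ᶠ_ : Form → Form → Form
  _⊗_  : Form → Form → Form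
  _∨ᶠ_ : Form → Form → Form
  _⇒_  : Form → Form → Form

data Classical : Form → Set where
  var  : ∀ p → Classical (var p)
  neg  : ∀ p → Classical (neg p)
  bot  : Classical bot
  top  : Classical top
  _∧ᶠ_ : ∀ {φ ψ} → Classical φ → Classical ψ → Classical (φ ∧ᶠ ψ)
  _⊗_  : ∀ {φ ψ} → Classical φ → Classical ψ → Classical (φ ⊗ ψ)
  _⇒_  : ∀ {φ ψ} → Classical φ → Classical ψ → Classical (φ ⇒ ψ)

⟦_⟧ : ∀ {φ} → Classical φ → Valuation → Bool
⟦ var p ⟧ v = v p
⟦ neg p ⟧ v = not (v p)
⟦ bot ⟧ v = false
⟦ top ⟧ v = true
⟦ c ∧ᶠ d ⟧ v = ⟦ c ⟧ v ∧ ⟦ d ⟧ v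
⟦ c ⊗ d ⟧ v = ⟦ c ⟧ v ∨ ⟦ d ⟧ v
⟦ c ⇒ d ⟧ v = not (⟦ c ⟧ v) ∨ ⟦ d ⟧ v

Tautology : ∀ {φ} → Classical φ → Set
Tautology c = ∀ v → ⟦ c ⟧ v ≡ true

Agree : List Prop → Valuation → Valuation → Set
Agree ps v w = All (λ p → v p ≡ w p) ps

_⊨_ : Team → Form → Set₁
X ⊨ var p = Lift (suc zero) (∀ v → X v → v p ≡ true)
X ⊨ neg p = Lift (suc zero) (∀ v → X v → v p ≡ false)
X ⊨ bot = Lift (suc zero) (∀ v → ¬ X v)
X ⊨ top = Lift (suc zero) ⊤
X ⊨ dep ps q = Lift (suc zero) (∀ v w → X v → X w → Agree ps v w → v q ≡ w q)
X ⊨ (φ ∧ᶠ ψ) = (X ⊨ φ) × (X ⊨ ψ)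
X ⊨ (φ ⊗ ψ) = Σ Team λ Y → Σ Team λ Z →
                (Y ⊆ X) × (Z ⊆ X) × (∀ v → X v → Y v ⊎ Z v)
                × (Y ⊨ φ) × (Z ⊨ ψ)
X ⊨ (φ ∨ᶠ ψ) = (X ⊨ φ) ⊎ (X ⊨ ψ)
X ⊨ (φ ⇒ ψ) = ∀ Y → Y ⊆ X → Y ⊨ φ → Y ⊨ ψ

Valid : Form → Set₁
Valid φ = ∀ X → X ⊨ φ

-- Classical formulas are flat: a team satisfies φ exactly when every valuation
-- in it makes the truth-table reading of φ true.  Validity then reduces to the
-- full team, i.e. to truth at every valuation.  Flatness is proved by induction
-- on φ; the only non-local cases are ⊗, where the witnessing split of X is
-- {v ∈ X | φ true at v} ∪ {v ∈ X | ψ true at v}, and →, where flatness of the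
-- antecedent on the singleton team {v} lets the implication be tested pointwise.
module Submission where

open import Defs
open import Data.Bool using (true; false; _∧_; _∨_; not)
open import Data.Bool.Properties using (∧-conicalˡ; ∧-conicalʳ)
open import Data.Empty using (⊥-elim)
open import Data.Product using (_×_; _,_; proj₁; proj₂)
open import Data.Sum using (_⊎_; inj₁; inj₂)
open import Data.Unit using (tt)
import Data.Unit as Unit
open import Function.Base using (case_of_)
open import Function.Bundles using (_⇔_; mk⇔)
open import Level using (lift)
open import Relation.Binary.PropositionalEquality using (_≡_; refl; cong)

∧-intro : ∀ {a b} → a ≡ true → b ≡ true → a ∧ b ≡ true
∧-intro refl refl = refl

∨-introˡ : ∀ {a} b → a ≡ true → a ∨ b ≡ true
∨-introˡ b refl = refl

∨-introʳ : ∀ a {b} → b ≡ true → a ∨ b ≡ true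
∨-introʳ true  _ = refl
∨-introʳ false p = p

∨-elim : ∀ a {b} → a ∨ b ≡ true → a ≡ true ⊎ b ≡ true
∨-elim true  _ = inj₁ refl
∨-elim false p = inj₂ p

not-true⇒false : ∀ {a} → not a ≡ true → a ≡ false
not-true⇒false {false} _ = refl

→-intro : ∀ a {b} → (a ≡ true → b ≡ true) → not a ∨ b ≡ true
→-intro true  f = f refl
→-intro false _ = refl

→-elim : ∀ {a b} → not a ∨ b ≡ true → a ≡ true → b ≡ true
→-elim p refl = p

｛_｝ : Valuation → Team
｛ v ｝ w = w ≡ v

Full : Team
Full _ = Unit.⊤

TrueOn : ∀ {φ} → Classical φ → Team → Set
TrueOn c X = ∀ v → X v → ⟦ c ⟧ v ≡ true

⊨⇒TrueOn : ∀ {φ} (c : Classical φ) X → X ⊨ φ → TrueOn c X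
TrueOn⇒⊨ : ∀ {φ} (c : Classical φ) X → TrueOn c X → X ⊨ φ

⊨⇒TrueOn (var p) X (lift h) = h
⊨⇒TrueOn (neg p) X (lift h) v x = cong not (h v x)
⊨⇒TrueOn bot X (lift h) v x = ⊥-elim (h v x)
⊨⇒TrueOn top X _ _ _ = refl
⊨⇒TrueOn (c ∧ᶠ d) X (hc , hd) v x = ∧-intro (⊨⇒TrueOn c X hc v x) (⊨⇒TrueOn d X hd v x)
⊨⇒TrueOn (c ⊗ d) X (Y , Z , _ , _ , cover , hY , hZ) v x with cover v x
... | inj₁ y = ∨-introˡ (⟦ d ⟧ v) (⊨⇒TrueOn c Y hY v y)
... | inj₂ z = ∨-introʳ (⟦ c ⟧ v) (⊨⇒TrueOn d Z hZ v z)
⊨⇒TrueOn (c ⇒ d) X h v x = →-intro (⟦ c ⟧ v) λ cv →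
  ⊨⇒TrueOn d ｛ v ｝ (h ｛ v ｝ v∈X (TrueOn⇒⊨ c ｛ v ｝ λ { _ refl → cv })) v refl
  where
  v∈X : ｛ v ｝ ⊆ X
  v∈X _ refl = x

TrueOn⇒⊨ (var p) X h = lift h
TrueOn⇒⊨ (neg p) X h = lift λ v x → not-true⇒false (h v x)
TrueOn⇒⊨ bot X h = lift λ v x → case h v x of λ ()
TrueOn⇒⊨ top X _ = lift tt
TrueOn⇒⊨ (c ∧ᶠ d) X h =
  TrueOn⇒⊨ c X (λ v x → ∧-conicalˡ _ _ (h v x)) ,
  TrueOn⇒⊨ d X (λ v x → ∧-conicalʳ _ _ (h v x))
TrueOn⇒⊨ (c ⊗ d) X h =
  Xc , Xd , (λ _ → proj₁) , (λ _ → proj₁) , cover ,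
  TrueOn⇒⊨ c Xc (λ _ → proj₂) , TrueOn⇒⊨ d Xd (λ _ → proj₂)
  where
  Xc Xd : Team
  Xc v = X v × ⟦ c ⟧ v ≡ true
  Xd v = X v × ⟦ d ⟧ v ≡ true

  cover : ∀ v → X v → Xc v ⊎ Xd v
  cover v x with ∨-elim (⟦ c ⟧ v) (h v x)
  ... | inj₁ cv = inj₁ (x , cv)
  ... | inj₂ dv = inj₂ (x , dv)
TrueOn⇒⊨ (c ⇒ d) X h Y Y⊆X hY =
  TrueOn⇒⊨ d Y λ v y → →-elim (h v (Y⊆X v y)) (⊨⇒TrueOn c Y hY v y)

lemma2p6 : ∀ {φ} (c : Classical φ) → Tautology c ⇔ Valid φ
lemma2p6 c = mk⇔
  (λ taut X → TrueOn⇒⊨ c X (λ v _ → taut v))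
  (λ valid v → ⊨⇒TrueOn c Full (valid Full) v tt)
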